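{- Let $L,M$ be finite posets and $\mu:\mathcal S(h_L)\to\mathcal S(h_M)$ a Heyting algebra homomorphism, and define $\mu^*_P:h_M(P)\to h_L(P)$ by $\mu^*_P(u)=\overline{ev_u\circ\mu}$. Then: (i) for $X\in\mathcal S(h_L)$ and $u\in h_M(P)$, $\mu^*_P(u)\in X_P$ iff $u\in\mu(X)_P$; (ii) $\mu^*:h_M\to h_L$ is a natural transformation having a b-index (a morphism of $\mathbf{M_H}$); (iii) $\mu=(\mu^*)^{ -1}$, i.e. $\mu(X)=(\mu^*)^{ -1}(X)$ for all $X\in\mathcal S(h_L)$; (iv) $f=(f^{ -1})^*$ for every natural transformation $f:h_M\to h_L$ having a b-index (where $f^{ -1}:\mathcal S(h_L)\to\mathcal S(h_M)$ is the inverse-image homomorphism).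
   Context: $\mathbf P_0$: category of finite posets with a greatest element (root $\rho(P)$) and open (p-)morphisms $h:Q\to P$ (order-preserving, and whenever $p'\le h(q)$ there is $q'\le q$ with $h(q')=p'$). $\downarrow p=\{p'\le p\}$. For a finite poset $L$, $h_L$ is the presheaf on $\mathbf P_0$ with $h_L(P)$ the order-preserving maps $u:P\to L$ and restriction $u\mapsto u\circ h$; $u_p$ is the restriction of $u$ to $\downarrow p$. $u\sim_0 v$ iff $u(\rho(P))=v(\rho(Q))$; $u\sim_{n+1}v$ iff every $p\in P$ has $q\in Q$ with $u_p\sim_n v_q$ and every $q\in Q$ has $p\in P$ with $u_p\sim_n v_q$. A subpresheaf $S\subseteq h_L$ has b-index $n$ if $u\in S_P$, $u\sim_n v$ imply $v\in S_Q$; $\mathcal S(h_L)$ is the Heyting algebra of subpresheaves with some b-index. A natural transformation $f:h_L\to h_M$ has b-index $n$ if $u\sim_n v$ implies $f(u)\sim_0 f(v)$; for such $f$, $f^{ -1}$ maps $\mathcal S(h_M)$ into $\mathcal S(h_L)$ as a Heyting algebra homomorphism. $\mathcal D(P)$ is the Heyting algebra of downsets of a finite poset $P$; $\iota_L:\mathcal D(L)\to\mathcal S(h_L)$, $\iota_L(d)_P=\{u\mid u(\rho(P))\in d\}$. For order-preserving $u:P\to M$, $ev_u:\mathcal S(h_M)\to\mathcal D(P)$ is $ev_u(X)=\{p\in P\mid u_p\in X_{\downarrow p}\}$, a Heyting algebra homomorphism. For a Heyting algebra homomorphism $\alpha:\mathcal S(h_L)\to\mathcal D(P)$, $\overline\alpha:P\to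 L$ is the order-preserving map Birkhoff-dual to the bounded lattice homomorphism $\alpha\circ\iota_L$, i.e. $\overline\alpha(p)$ is the unique $l\in L$ such that for all $d\in\mathcal D(L)$: $l\in d$ iff $p\in\alpha(\iota_L(d))$. -}

module Defs where

open import Level using (Level)
open import Data.Nat using (ℕ; zero; suc)
open import Data.Bool using (Bool; true; false; T)
open import Data.Bool.Properties using (T?; T-irrelevant)
open import Data.Empty using (⊥; ⊥-elim)
open import Data.Product using (Σ; Σ-syntax; _×_; _,_; proj₁; proj₂)
open import Data.Sum using (_⊎_)
open import Data.List using (List; []; _∷_)
open import Data.List.Membership.Propositional using (_∈_)
open import Data.List.Relation.Unary.Any using (here; there)
open import Relation.Nullary using (¬_; yes; no)
open import Relation.Binary.PropositionalEquality using (_≡_; refl; cong; subst)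
open import Function.Bundles using (_⇔_)

-- Finite posets.  The order is Bool-valued (so decidable and
-- proof-irrelevant); finiteness is witnessed by a complete enumeration.

record FinPoset : Set₁ where
  field
    Carrier  : Set
    le       : Carrier → Carrier → Bool
    le-refl  : ∀ x → T (le x x)
    le-trans : ∀ {x y z} → T (le x y) → T (le y z) → T (le x z)
    le-antisym : ∀ {x y} → T (le x y) → T (le y x) → x ≡ y
    enum     : List Carrier
    complete : ∀ x → x ∈ enum

open FinPoset public

record Rooted : Set₁ where
  field
    poset : FinPoset
    ρ     : Carrier poset
    ρ-top : ∀ x → T (le poset x ρ)

open Rooted public

⌞_⌟ : Rooted → Set
⌞ P ⌟ = Carrier (poset P)

≤ᴾ : (P : Rooted) → ⌞ P ⌟ → ⌞ P ⌟ → Set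
≤ᴾ P x y = T (le (poset P) x y)

-- Order-preserving maps u : P → L  (elements of h_L(P) when P is rooted).
record Mono (P : Rooted) (L : FinPoset) : Set where
  field
    fun  : ⌞ P ⌟ → Carrier L
    mono : ∀ {x y} → ≤ᴾ P x y → T (le L (fun x) (fun y))

open Mono public

record Open (Q P : Rooted) : Set where
  field
    map   : ⌞ Q ⌟ → ⌞ P ⌟
    mono  : ∀ {x y} → ≤ᴾ Q x y → ≤ᴾ P (map x) (map y)
    back  : ∀ (q : ⌞ Q ⌟) (p' : ⌞ P ⌟) → ≤ᴾ P p' (map q) →
            Σ[ q' ∈ ⌞ Q ⌟ ] (≤ᴾ Q q' q × map q' ≡ p')

open Open public renaming (map to omap; mono to omono)

_∘ᵒ_ : {L : FinPoset} {P Q : Rooted} → Mono P L → Open Q P → Mono Q L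
u ∘ᵒ h = record { fun = λ q → fun u (omap h q) ; mono = λ x≤y → mono u (omono h x≤y) }

module Down (P : Rooted) (p : ⌞ P ⌟) where
  Elt : Set
  Elt = Σ[ x ∈ ⌞ P ⌟ ] ≤ᴾ P x p

  sub : List ⌞ P ⌟ → List Elt
  sub [] = []
  sub (x ∷ xs) with T? (le (poset P) x p)
  ... | yes t = (x , t) ∷ sub xs
  ... | no _  = sub xs

  sub-complete : ∀ xs x (t : ≤ᴾ P x p) → x ∈ xs → (x , t) ∈ sub xs
  sub-complete (y ∷ xs) x t (here refl) with T? (le (poset P) x p)
  ... | yes t' = here (cong (x ,_) (T-irrelevant t t'))
  ... | no ¬t  = ⊥-elim (¬t t)
  sub-complete (y ∷ xs) x t (there m) with T? (le (poset P) y p)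
  ... | yes _ = there (sub-complete xs x t m)
  ... | no _  = sub-complete xs x t m

  down-poset : FinPoset
  down-poset = record
    { Carrier = Elt
    ; le = λ a b → le (poset P) (proj₁ a) (proj₁ b)
    ; le-refl = λ a → le-refl (poset P) (proj₁ a)
    ; le-trans = le-trans (poset P)
    ; le-antisym = λ {a} {b} a≤b b≤a → antisym' a b (le-antisym (poset P) a≤b b≤a)
    ; enum = sub (enum (poset P))
    ; complete = λ a → sub-complete (enum (poset P)) (proj₁ a) (proj₂ a)
                         (complete (poset P) (proj₁ a))
    }
    where
      antisym' : (a b : Elt) → proj₁ a ≡ proj₁ b → a ≡ b
      antisym' (x , s) (.x , t) refl = cong (x ,_) (T-irrelevant s t)

  down : Rooted
  down = record { poset = down-poset ; ρ = (p , le-refl (poset P) p) ; ρ-top = proj₂ }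

↓ : (P : Rooted) → ⌞ P ⌟ → Rooted
↓ P p = Down.down P p

restrict : {L : FinPoset} {P : Rooted} → Mono P L → (p : ⌞ P ⌟) → Mono (↓ P p) L
restrict u p = record { fun = λ a → fun u (proj₁ a) ; mono = mono u }

_∼[_]_ : {L : FinPoset} {P Q : Rooted} → Mono P L → ℕ → Mono Q L → Set
_∼[_]_ {P = P} {Q} u zero v = fun u (ρ P) ≡ fun v (ρ Q)
_∼[_]_ {P = P} {Q} u (suc n) v =
  (∀ (p : ⌞ P ⌟) → Σ[ q ∈ ⌞ Q ⌟ ] (restrict u p ∼[ n ] restrict v q)) ×
  (∀ (q : ⌞ Q ⌟) → Σ[ p ∈ ⌞ P ⌟ ] (restrict u p ∼[ n ] restrict v q))

-- 𝒮(h_L): subpresheaves of h_L having some b-index.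

record SubB (L : FinPoset) : Set₁ where
  field
    mem    : (P : Rooted) → Mono P L → Bool
    restr  : ∀ {P Q : Rooted} (h : Open Q P) (u : Mono P L) →
             T (mem P u) → T (mem Q (u ∘ᵒ h))
    bindex : ℕ
    bclosed : ∀ {P Q : Rooted} (u : Mono P L) (v : Mono Q L) →
              T (mem P u) → u ∼[ bindex ] v → T (mem Q v)

open SubB public

_∈ₛ_ : {L : FinPoset} {P : Rooted} → Mono P L → SubB L → Set
_∈ₛ_ {P = P} u X = T (mem X P u)

_≈ₛ_ : {L : FinPoset} → SubB L → SubB L → Set₁
X ≈ₛ Y = ∀ (P : Rooted) (u : Mono _ _) → _∈ₛ_ {P = P} u X ⇔ _∈ₛ_ {P = P} u Y

IsTop : {L : FinPoset} → SubB L → Set₁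
IsTop X = ∀ (P : Rooted) (u : Mono P _) → u ∈ₛ X

IsBot : {L : FinPoset} → SubB L → Set₁
IsBot X = ∀ (P : Rooted) (u : Mono P _) → ¬ (u ∈ₛ X)

IsMeet : {L : FinPoset} → SubB L → SubB L → SubB L → Set₁
IsMeet Z X Y = ∀ (P : Rooted) (u : Mono P _) → (u ∈ₛ Z) ⇔ (u ∈ₛ X × u ∈ₛ Y)

IsJoin : {L : FinPoset} → SubB L → SubB L → SubB L → Set₁
IsJoin Z X Y = ∀ (P : Rooted) (u : Mono P _) → (u ∈ₛ Z) ⇔ (u ∈ₛ X ⊎ u ∈ₛ Y)

IsImp : {L : FinPoset} → SubB L → SubB L → SubB L → Set₁
IsImp Z X Y = ∀ (P : Rooted) (u : Mono P _) →
  (u ∈ₛ Z) ⇔ (∀ (Q : Rooted) (h : Open Q P) → (u ∘ᵒ h) ∈ₛ X → (u ∘ᵒ h) ∈ₛ Y)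

record IsHeytingHom {L M : FinPoset} (μ : SubB L → SubB M) : Set₁ where
  field
    μ-cong : ∀ {X Y} → X ≈ₛ Y → μ X ≈ₛ μ Y
    μ-top  : ∀ {X} → IsTop X → IsTop (μ X)
    μ-bot  : ∀ {X} → IsBot X → IsBot (μ X)
    μ-meet : ∀ {Z X Y} → IsMeet Z X Y → IsMeet (μ Z) (μ X) (μ Y)
    μ-join : ∀ {Z X Y} → IsJoin Z X Y → IsJoin (μ Z) (μ X) (μ Y)
    μ-imp  : ∀ {Z X Y} → IsImp Z X Y → IsImp (μ Z) (μ X) (μ Y)

record Downset (L : FinPoset) : Set where
  field
    dmem   : Carrier L → Bool
    dclosed : ∀ {x y} → T (le L x y) → T (dmem y) → T (dmem x)

open Downset public

ι : {L : FinPoset} → Downset L → SubB L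
ι {L} d = record
  { mem = λ P u → dmem d (fun u (ρ P))
  ; restr = λ {P} {Q} h u t → dclosed d (mono u (ρ-top P (omap h (ρ Q)))) t
  ; bindex = zero
  ; bclosed = λ u v t eq → subst (λ x → T (dmem d x)) eq t
  }

-- Given a map α : 𝒮(h_L) → 𝒟(P) (here described by the
-- membership predicate "p ∈ α(X)"), a map g : P → L is the Birkhoff dual
-- ᾱ iff for every p and every downset d of L:  g(p) ∈ d ⟺ p ∈ α(ι_L d).
IsDualOf : {L : FinPoset} {P : Rooted} →
           (SubB L → ⌞ P ⌟ → Set) → (⌞ P ⌟ → Carrier L) → Set
IsDualOf {L} {P} α g = ∀ (p : ⌞ P ⌟) (d : Downset L) → T (dmem d (g p)) ⇔ α (ι d) p

ev : {M : FinPoset} {P : Rooted} → Mono P M → SubB M → ⌞ P ⌟ → Set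
ev u X p = restrict u p ∈ₛ X

Family : FinPoset → FinPoset → Set₁
Family M L = (P : Rooted) → Mono P M → Mono P L

-- g is the family (−)* of a map m : 𝒮(h_L) → 𝒮(h_M) (given by the
-- membership predicates of m(X)): g_P(u) = the Birkhoff dual of ev_u ∘ m.
IsStar : {L M : FinPoset} → (SubB L → (P : Rooted) → Mono P M → Set) → Family M L → Set₁
IsStar {L} {M} m g = ∀ (P : Rooted) (u : Mono P M) →
  IsDualOf {L} {P} (λ X p → m X (↓ P p) (restrict u p)) (fun (g P u))

IsNatural : {L M : FinPoset} → Family M L → Set₁
IsNatural g = ∀ {P Q : Rooted} (h : Open Q P) (u : Mono P _) (q : ⌞ Q ⌟) →
  fun (g Q (u ∘ᵒ h)) q ≡ fun (g P u) (omap h q)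

HasBIndex : {L M : FinPoset} → Family M L → ℕ → Set₁
HasBIndex g n = ∀ {P Q : Rooted} (u : Mono P _) (v : Mono Q _) →
  u ∼[ n ] v → g P u ∼[ zero ] g Q v

preimage : {L M : FinPoset} → Family M L → SubB L → (P : Rooted) → Mono P M → Set
preimage f X P u = f P u ∈ₛ X

-- μ*(u) sends p to the least l with u_p ∈ μ(ι(↓l)).  Membership in a subpresheaf
-- of b-index n only depends on the ∼ₙ-class, which makes μ* natural and gives it a
-- b-index.  The equivalence μ*(u) ∈ X ⟺ u ∈ μ(X) holds on ι(𝒟(L)) by construction
-- and, μ* being natural, is preserved by the Heyting operations.  For X of b-index n
-- and w = μ*(u), two formulas over ι(𝒟(L)) transfer it to X: one holds of the
-- valuations all of whose points have the ∼ₙ-type of some point of w (if w ∈ X, all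
-- of them lie in X), the other of the valuations with no point of the ∼ₙ-type of w
-- (if w ∉ X, X lies inside it).  Both are defined by recursion on n, describing a
-- ∼ₖ₊₁-type by its root value and the set of ∼ₖ-types of its points.  Part (iv) is
-- naturality of f at the inclusion ↓p ↪ P.

module Submission where

open import Defs
open import Data.Nat using (ℕ; zero; suc; _⊔_; _≤_; s≤s)
open import Data.Nat.Properties using (m≤m⊔n; m≤n⊔m; n≤1+n)
open import Data.Bool using (true; false; T; _∧_; _∨_)
open import Data.Bool.Properties using (T?; T-irrelevant; T-∧; T-∨)
open import Data.Unit using (⊤; tt)
open import Data.Empty using (⊥-elim)
open import Data.Product using (Σ-syntax; _×_; _,_; proj₁; proj₂)
open import Data.Product.Function.NonDependent.Propositional using (_×-⇔_)
open import Data.Sum using (_⊎_; inj₁; inj₂; [_,_]; map₂) renaming (map to ⊎-map)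
open import Data.Sum.Function.Propositional using (_⊎-⇔_)
open import Data.List using (List; []; _∷_; _++_; map; filter)
open import Data.List.Membership.Propositional using (_∈_; find; lose)
open import Data.List.Membership.Propositional.Properties
  using (∈-filter⁺; ∈-filter⁻; ∈-map⁺; ∈-++⁺ˡ; ∈-++⁺ʳ)
open import Data.List.Relation.Unary.Any using (here; there; any?)
open import Data.List.Relation.Unary.All using (all?) renaming (lookup to All-lookup; tabulate to All-tabulate)
open import Data.List.Extrema.Nat using (max; xs≤max)
open import Relation.Nullary using (¬_; Dec; yes; no; does)
open import Relation.Nullary.Decidable
  using (map′; _×-dec_; _→-dec_; ¬?; isYes; toWitness; fromWitness; decidable-stable)
open import Relation.Unary using (Decidable)
open import Relation.Binary.PropositionalEquality using (_≡_; refl; cong; subst; sym; trans)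
open import Function.Bundles using (_⇔_; mk⇔; module Equivalence)
open import Function.Properties.Equivalence using () renaming (trans to ⇔-trans; sym to ⇔-sym)

open Equivalence using (to; from)

module _ {A : Set} where

  ∀∈? : {B : A → Set} (xs : List A) → (∀ x → Dec (B x)) → Dec (∀ x → x ∈ xs → B x)
  ∀∈? xs B? = map′ (λ all x → All-lookup all) (λ h → All-tabulate (h _)) (all? B? xs)

  ∃∈? : {B : A → Set} (xs : List A) → (∀ x → Dec (B x)) → Dec (Σ[ x ∈ A ] (x ∈ xs × B x))
  ∃∈? xs B? = map′ find (λ (x , x∈ , b) → lose x∈ b) (any? B? xs)

  ¬∀∈⇒∃∈¬ : {B : A → Set} (xs : List A) → (∀ x → Dec (B x)) → ¬ (∀ x → x ∈ xs → B x) →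
            Σ[ x ∈ A ] (x ∈ xs × ¬ B x)
  ¬∀∈⇒∃∈¬ xs B? ¬all with ∃∈? xs (λ x → ¬? (B? x))
  ... | yes counterexample = counterexample
  ... | no ¬ex = ⊥-elim (¬all λ x x∈ → decidable-stable (B? x) (λ ¬b → ¬ex (x , x∈ , ¬b)))

module _ (A : FinPoset) {B : Carrier A → Set} where

  ∀? : (∀ x → Dec (B x)) → Dec (∀ x → B x)
  ∀? B? = map′ (λ h x → h x (complete A x)) (λ h x _ → h x) (∀∈? (enum A) B?)

  ∃? : (∀ x → Dec (B x)) → Dec (Σ[ x ∈ Carrier A ] B x)
  ∃? B? = map′ (λ (x , _ , b) → x , b) (λ (x , b) → x , complete A x , b) (∃∈? (enum A) B?)

_≟_ : {L : FinPoset} (a b : Carrier L) → Dec (a ≡ b)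
_≟_ {L} a b with T? (le L a b) | T? (le L b a)
... | yes a≤b | yes b≤a = yes (le-antisym L a≤b b≤a)
... | no a≰b  | _       = no λ { refl → a≰b (le-refl L a) }
... | yes _   | no b≰a  = no λ { refl → b≰a (le-refl L a) }

module _ {L : FinPoset} where

  ∼-sym : ∀ {P Q} n (u : Mono P L) (v : Mono Q L) → u ∼[ n ] v → v ∼[ n ] u
  ∼-sym zero    u v u∼v     = sym u∼v
  ∼-sym (suc n) u v (f , g) =
    (λ q → let p , r = g q in p , ∼-sym n _ _ r) ,
    (λ p → let q , r = f p in q , ∼-sym n _ _ r)

  ∼-trans : ∀ {P Q R} n (u : Mono P L) (v : Mono Q L) (w : Mono R L) →
            u ∼[ n ] v → v ∼[ n ] w → u ∼[ n ] w
  ∼-trans zero    u v w u∼v v∼w = trans u∼v v∼w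
  ∼-trans (suc n) u v w (f₁ , g₁) (f₂ , g₂) =
    (λ p → let q , r₁ = f₁ p ; s , r₂ = f₂ q in s , ∼-trans n _ _ _ r₁ r₂) ,
    (λ s → let q , r₂ = g₂ s ; p , r₁ = g₁ q in p , ∼-trans n _ _ _ r₁ r₂)

  ∼⇒∼₀ : ∀ {P Q} n (u : Mono P L) (v : Mono Q L) → u ∼[ n ] v → u ∼[ zero ] v
  ∼⇒∼₀ zero u v u∼v = u∼v
  ∼⇒∼₀ {P} {Q} (suc n) u v (f , g) = le-antisym L u≤v v≤u
    where
      u≤v : T (le L (fun u (ρ P)) (fun v (ρ Q)))
      u≤v = let q , r = f (ρ P) in
        subst (λ z → T (le L z (fun v (ρ Q)))) (sym (∼⇒∼₀ n _ _ r)) (mono v (ρ-top Q q))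
      v≤u : T (le L (fun v (ρ Q)) (fun u (ρ P)))
      v≤u = let p , r = g (ρ Q) in
        subst (λ z → T (le L z (fun u (ρ P)))) (∼⇒∼₀ n _ _ r) (mono u (ρ-top P p))

  ∼-weaken : ∀ {P Q m n} → m ≤ n → (u : Mono P L) (v : Mono Q L) → u ∼[ n ] v → u ∼[ m ] v
  ∼-weaken {m = zero} {n} _ u v u∼v = ∼⇒∼₀ n u v u∼v
  ∼-weaken {m = suc m} {suc n} (s≤s m≤n) u v (f , g) =
    (λ p → let q , r = f p in q , ∼-weaken m≤n _ _ r) ,
    (λ q → let p , r = g q in p , ∼-weaken m≤n _ _ r)

  _∼?[_]_ : ∀ {P Q} (u : Mono P L) n (v : Mono Q L) → Dec (u ∼[ n ] v)
  _∼?[_]_ {P} {Q} u zero    v = _≟_ {L} (fun u (ρ P)) (fun v (ρ Q))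
  _∼?[_]_ {P} {Q} u (suc n) v =
    ∀? (poset P) (λ p → ∃? (poset Q) (λ q → restrict u p ∼?[ n ] restrict v q)) ×-dec
    ∀? (poset Q) (λ q → ∃? (poset P) (λ p → restrict u p ∼?[ n ] restrict v q))

_≃_ : {L : FinPoset} {P Q : Rooted} → Mono P L → Mono Q L → Set
u ≃ v = ∀ n → u ∼[ n ] v

module _ {L : FinPoset} {P Q : Rooted} {u : Mono P L} {v : Mono Q L} where

  ≃-sym : u ≃ v → v ≃ u
  ≃-sym u≃v n = ∼-sym n _ _ (u≃v n)

  ∈ₛ-resp-≃ : (X : SubB L) → u ≃ v → u ∈ₛ X → v ∈ₛ X
  ∈ₛ-resp-≃ X u≃v u∈X = bclosed X u v u∈X (u≃v (bindex X))

-- Open maps and bisimilarity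

↓-≡ : {P : Rooted} {p : ⌞ P ⌟} {a b : ⌞ ↓ P p ⌟} → proj₁ a ≡ proj₁ b → a ≡ b
↓-≡ {a = x , _} {.x , _} refl = cong (x ,_) (T-irrelevant _ _)

↓-open : {Q P : Rooted} (h : Open Q P) (q : ⌞ Q ⌟) → Open (↓ Q q) (↓ P (omap h q))
↓-open {Q} {P} h q = record
  { map  = λ a → omap h (proj₁ a) , omono h (proj₂ a)
  ; mono = omono h
  ; back = λ a b b≤ha → let q' , q'≤a , hq'≡b = back h (proj₁ a) (proj₁ b) b≤ha in
      (q' , le-trans (poset Q) q'≤a (proj₂ a)) , q'≤a , ↓-≡ {P} hq'≡b
  }

≃-along-open : ∀ {L} {Q P : Rooted} (h : Open Q P) → (∀ p → ≤ᴾ P p (omap h (ρ Q))) →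
               (v : Mono Q L) (u : Mono P L) → (∀ x → fun v x ≡ fun u (omap h x)) → v ≃ u
≃-along-open {Q = Q} {P} h onto-root v u v≡uh zero =
  trans (v≡uh (ρ Q)) (cong (fun u) (le-antisym (poset P) (ρ-top P _) (onto-root (ρ P))))
≃-along-open {Q = Q} {P} h onto-root v u v≡uh (suc n) = zig , zag
  where
    zig : ∀ q → Σ[ p ∈ ⌞ P ⌟ ] (restrict v q ∼[ n ] restrict u p)
    zig q = omap h q ,
      ≃-along-open (↓-open h q) proj₂ (restrict v q) (restrict u (omap h q)) (λ x → v≡uh (proj₁ x)) n
    zag : ∀ p → Σ[ q ∈ ⌞ Q ⌟ ] (restrict v q ∼[ n ] restrict u p)
    zag p = let q , _ , hq≡p = back h (ρ Q) p (onto-root p) in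
      q , subst (λ z → restrict v q ∼[ n ] restrict u z) hq≡p (proj₂ (zig q))

idₒ : (P : Rooted) → Open P P
idₒ P = record { map = λ x → x ; mono = λ x≤y → x≤y ; back = λ _ p' p'≤ → p' , p'≤ , refl }

inclₒ : (P : Rooted) (p : ⌞ P ⌟) → Open (↓ P p) P
inclₒ P p = record
  { map = proj₁ ; mono = λ x≤y → x≤y
  ; back = λ a y y≤a → (y , le-trans (poset P) y≤a (proj₂ a)) , y≤a , refl }

toRootₒ : {Q P : Rooted} (h : Open Q P) → Open Q (↓ P (omap h (ρ Q)))
toRootₒ {Q} {P} h = record
  { map  = λ x → omap h x , omono h (ρ-top Q x)
  ; mono = omono h
  ; back = λ x b b≤hx → let x' , x'≤x , hx'≡b = back h x (proj₁ b) b≤hx in x' , x'≤x , ↓-≡ {P} hx'≡b }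

module _ {L : FinPoset} where

  ≃-pointwise : {P : Rooted} (u v : Mono P L) → (∀ x → fun u x ≡ fun v x) → u ≃ v
  ≃-pointwise {P} u v = ≃-along-open (idₒ P) (ρ-top P) u v

  ≃-refl : {P : Rooted} (u : Mono P L) → u ≃ u
  ≃-refl u = ≃-pointwise u u (λ _ → refl)

  restrict-ρ-≃ : {P : Rooted} (u : Mono P L) → restrict u (ρ P) ≃ u
  restrict-ρ-≃ {P} u = ≃-along-open (inclₒ P (ρ P)) (ρ-top P) _ u (λ _ → refl)

  ∘ᵒ-≃-restrict : {Q P : Rooted} (h : Open Q P) (u : Mono P L) → (u ∘ᵒ h) ≃ restrict u (omap h (ρ Q))
  ∘ᵒ-≃-restrict h u = ≃-along-open (toRootₒ h) proj₂ _ _ (λ _ → refl)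

  restrict-∘ᵒ-≃ : {Q P : Rooted} (h : Open Q P) (u : Mono P L) (q : ⌞ Q ⌟) →
                  restrict (u ∘ᵒ h) q ≃ restrict u (omap h q)
  restrict-∘ᵒ-≃ h u q = ≃-along-open (↓-open h q) proj₂ _ _ (λ _ → refl)

  restrict-restrict-≃ : {P : Rooted} (u : Mono P L) (r : ⌞ P ⌟) (s : ⌞ ↓ P r ⌟) →
                        restrict (restrict u r) s ≃ restrict u (proj₁ s)
  restrict-restrict-≃ {P} u r = restrict-∘ᵒ-≃ (inclₒ P r) u

  ∈ₛ-restrict : {P : Rooted} (X : SubB L) (u : Mono P L) (p : ⌞ P ⌟) → u ∈ₛ X → restrict u p ∈ₛ X
  ∈ₛ-restrict {P} X u p u∈X = restr X (inclₒ P p) u u∈X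

  ∈ₛ-resp-∼ : {P Q : Rooted} {n : ℕ} (X : SubB L) → bindex X ≤ n → {u : Mono P L} {v : Mono Q L} →
              u ∼[ n ] v → u ∈ₛ X → v ∈ₛ X
  ∈ₛ-resp-∼ X bX≤n {u} {v} u∼v u∈X = bclosed X u v u∈X (∼-weaken bX≤n u v u∼v)

module _ {L : FinPoset} where

  ⊤ₛ : SubB L
  ⊤ₛ = record { mem = λ _ _ → true ; restr = λ _ _ _ → tt ; bindex = 0 ; bclosed = λ _ _ _ _ → tt }

  ⊥ₛ : SubB L
  ⊥ₛ = record { mem = λ _ _ → false ; restr = λ _ _ u∈ → u∈ ; bindex = 0 ; bclosed = λ _ _ u∈ _ → u∈ }

  _∧ₛ_ : SubB L → SubB L → SubB L
  X ∧ₛ Y = record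
    { mem     = λ P u → mem X P u ∧ mem Y P u
    ; restr   = λ h u u∈ → let x , y = to T-∧ u∈ in from T-∧ (restr X h u x , restr Y h u y)
    ; bindex  = bindex X ⊔ bindex Y
    ; bclosed = λ u v u∈ u∼v → let x , y = to T-∧ u∈ in
        from T-∧ (∈ₛ-resp-∼ X (m≤m⊔n _ _) u∼v x , ∈ₛ-resp-∼ Y (m≤n⊔m _ _) u∼v y)
    }

  _∨ₛ_ : SubB L → SubB L → SubB L
  X ∨ₛ Y = record
    { mem     = λ P u → mem X P u ∨ mem Y P u
    ; restr   = λ h u u∈ → from T-∨ (⊎-map (restr X h u) (restr Y h u) (to T-∨ u∈))
    ; bindex  = bindex X ⊔ bindex Y
    ; bclosed = λ u v u∈ u∼v → from T-∨
        (⊎-map (∈ₛ-resp-∼ X (m≤m⊔n _ _) u∼v) (∈ₛ-resp-∼ Y (m≤n⊔m _ _) u∼v) (to T-∨ u∈))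
    }

  -- As u ∘ h ≃ u_{h(ρ)} and membership is invariant under ≃, the presheaf
  -- implication only needs to be tested at the restrictions u_p.
  _⇒ₛ_ : SubB L → SubB L → SubB L
  X ⇒ₛ Y = record
    { mem     = λ P u → isYes (⇒-at-points? P u)
    ; restr   = λ {P} {Q} h u u∈ → fromWitness λ q x →
        let e = restrict-∘ᵒ-≃ h u q in
        ∈ₛ-resp-≃ Y (≃-sym e) (toWitness u∈ (omap h q) (∈ₛ-resp-≃ X e x))
    ; bindex  = suc (bindex X ⊔ bindex Y)
    ; bclosed = λ u v u∈ (_ , back) → fromWitness λ q x →
        let p , r = back q in
        ∈ₛ-resp-∼ Y (m≤n⊔m _ _) r
          (toWitness u∈ p (∈ₛ-resp-∼ X (m≤m⊔n _ _) (∼-sym _ _ _ r) x))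
    }
    where
      ⇒-at-points? : (P : Rooted) (u : Mono P L) →
                     Dec (∀ p → restrict u p ∈ₛ X → restrict u p ∈ₛ Y)
      ⇒-at-points? P u = ∀? (poset P) (λ p → T? _ →-dec T? _)

  ⇒ₛ-pointwise : (X Y : SubB L) {P : Rooted} (u : Mono P L) →
                 u ∈ₛ (X ⇒ₛ Y) ⇔ (∀ p → restrict u p ∈ₛ X → restrict u p ∈ₛ Y)
  ⇒ₛ-pointwise X Y u = mk⇔ toWitness fromWitness

  ⊤ₛ-isTop : IsTop ⊤ₛ
  ⊤ₛ-isTop _ _ = tt

  ⊥ₛ-isBot : IsBot ⊥ₛ
  ⊥ₛ-isBot _ _ ()

  ∧ₛ-isMeet : (X Y : SubB L) → IsMeet (X ∧ₛ Y) X Y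
  ∧ₛ-isMeet X Y _ _ = T-∧

  ∨ₛ-isJoin : (X Y : SubB L) → IsJoin (X ∨ₛ Y) X Y
  ∨ₛ-isJoin X Y _ _ = T-∨

  ⇒ₛ-isImp : (X Y : SubB L) → IsImp (X ⇒ₛ Y) X Y
  ⇒ₛ-isImp X Y P u = mk⇔
    (λ u∈ Q h x → let e = ∘ᵒ-≃-restrict h u in
       ∈ₛ-resp-≃ Y (≃-sym e) (to (⇒ₛ-pointwise X Y u) u∈ _ (∈ₛ-resp-≃ X e x)))
    (λ H → from (⇒ₛ-pointwise X Y u) λ p → H (↓ P p) (inclₒ P p))

  ⋀ₛ : {A : Set} → List A → (A → SubB L) → SubB L
  ⋀ₛ []       X = ⊤ₛ
  ⋀ₛ (a ∷ as) X = X a ∧ₛ ⋀ₛ as X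

  ⋁ₛ : {A : Set} → List A → (A → SubB L) → SubB L
  ⋁ₛ []       X = ⊥ₛ
  ⋁ₛ (a ∷ as) X = X a ∨ₛ ⋁ₛ as X

  ⋀ₛ-pointwise : {A : Set} (as : List A) (X : A → SubB L) {P : Rooted} (u : Mono P L) →
                 u ∈ₛ ⋀ₛ as X ⇔ (∀ a → a ∈ as → u ∈ₛ X a)
  ⋀ₛ-pointwise []       X u = mk⇔ (λ _ _ ()) (λ _ → tt)
  ⋀ₛ-pointwise (a ∷ as) X u = mk⇔
    (λ u∈ → let x , xs = to T-∧ u∈ in
      λ { _ (here refl) → x ; b (there b∈) → to (⋀ₛ-pointwise as X u) xs b b∈ })
    (λ H → from T-∧ (H a (here refl) , from (⋀ₛ-pointwise as X u) (λ b b∈ → H b (there b∈))))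

  ⋁ₛ-pointwise : {A : Set} (as : List A) (X : A → SubB L) {P : Rooted} (u : Mono P L) →
                 u ∈ₛ ⋁ₛ as X ⇔ (Σ[ a ∈ A ] (a ∈ as × u ∈ₛ X a))
  ⋁ₛ-pointwise []       X u = mk⇔ (λ ()) (λ ())
  ⋁ₛ-pointwise (a ∷ as) X u = mk⇔
    (λ u∈ → [ (λ x → a , here refl , x)
            , (λ xs → let b , b∈ , x = to (⋁ₛ-pointwise as X u) xs in b , there b∈ , x) ] (to T-∨ u∈))
    (λ { (_ , here refl , x) → from T-∨ (inj₁ x)
       ; (b , there b∈ , x) → from T-∨ (inj₂ (from (⋁ₛ-pointwise as X u) (b , b∈ , x))) })

  guardₛ : {B : Set} → Dec B → SubB L → SubB L
  guardₛ (yes _) X = X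
  guardₛ (no _)  X = ⊤ₛ

  guardₛ-pointwise : {B : Set} (B? : Dec B) (X : SubB L) {P : Rooted} (u : Mono P L) →
                     u ∈ₛ guardₛ B? X ⇔ (B → u ∈ₛ X)
  guardₛ-pointwise (yes b) X u = mk⇔ (λ u∈ _ → u∈) (λ H → H b)
  guardₛ-pointwise (no ¬b) X u = mk⇔ (λ _ b → ⊥-elim (¬b b)) (λ _ → tt)

module _ {L : FinPoset} where

  atMost : Carrier L → Downset L
  atMost l = record { dmem = λ x → le L x l ; dclosed = le-trans L }

  below : Carrier L → Downset L
  below l = record
    { dmem    = λ x → isYes (T? (le L x l) ×-dec ¬? (_≟_ {L} x l))
    ; dclosed = λ {x} {y} x≤y y∈ → let y≤l , y≢l = toWitness y∈ in
        fromWitness (le-trans L x≤y y≤l , λ { refl → y≢l (le-antisym L y≤l x≤y) })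
    }

  ≤-reflexive : {x y : Carrier L} → x ≡ y → T (le L x y)
  ≤-reflexive {x} refl = le-refl L x

  below-mem : {l x : Carrier L} → T (dmem (below l) x) ⇔ (T (le L x l) × ¬ x ≡ l)
  below-mem = mk⇔ toWitness fromWitness

  below⊎≡ : {l x : Carrier L} → T (le L x l) → T (dmem (below l) x) ⊎ x ≡ l
  below⊎≡ {l} {x} x≤l = split (_≟_ {L} x l)
    where
      split : Dec (x ≡ l) → T (dmem (below l) x) ⊎ x ≡ l
      split (yes x≡l) = inj₂ x≡l
      split (no x≢l)  = inj₁ (fromWitness (x≤l , x≢l))

  ⋁-atMost : {S : Carrier L → Set} → Decidable S → SubB L
  ⋁-atMost S? = ⋁ₛ (filter S? (enum L)) (λ l → ι (atMost l))

  ≈ₛ-⋁-atMost : {S : Carrier L → Set} (S? : Decidable S) → (∀ {x y} → T (le L x y) → S y → S x) →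
                (X : SubB L) → (∀ P (u : Mono P L) → u ∈ₛ X ⇔ S (fun u (ρ P))) → X ≈ₛ ⋁-atMost S?
  ≈ₛ-⋁-atMost {S} S? S-closed X X-at-root P u = mk⇔
    (λ u∈X → from (⋁ₛ-pointwise (filter S? (enum L)) _ u)
      (fun u (ρ P) , ∈-filter⁺ S? (complete L _) (to (X-at-root P u) u∈X) , le-refl L _))
    (λ u∈⋁ → let l , l∈ , uρ≤l = to (⋁ₛ-pointwise (filter S? (enum L)) (λ l → ι (atMost l)) u) u∈⋁ in
      from (X-at-root P u) (S-closed uρ≤l (proj₂ (∈-filter⁻ S? {xs = enum L} l∈))))

-- Characteristic formulas of ∼ₖ-types

sublists : {A : Set} → List A → List (List A)
sublists []       = [] ∷ []
sublists (x ∷ xs) = map (x ∷_) (sublists xs) ++ sublists xs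

[]∈sublists : {A : Set} (xs : List A) → [] ∈ sublists xs
[]∈sublists []       = here refl
[]∈sublists (x ∷ xs) = ∈-++⁺ʳ (map (x ∷_) (sublists xs)) ([]∈sublists xs)

filter∈sublists : {A : Set} {B : A → Set} (B? : Decidable B) (xs : List A) → filter B? xs ∈ sublists xs
filter∈sublists B? []       = here refl
filter∈sublists B? (x ∷ xs) with does (B? x)
... | true  = ∈-++⁺ˡ (∈-map⁺ (x ∷_) (filter∈sublists B? xs))
... | false = ∈-++⁺ʳ (map (x ∷_) (sublists xs)) (filter∈sublists B? xs)

-- A list E of points of P stands for the set of ∼ₖ-types of the w_e, e ∈ E.
module Types {L : FinPoset} {P : Rooted} (w : Mono P L) where

  pointsBelow : ⌞ P ⌟ → List ⌞ P ⌟
  pointsBelow e = filter (λ q → T? (le (poset P) q e)) (enum (poset P))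

  Realises : ℕ → {Q : Rooted} → Mono Q L → List ⌞ P ⌟ → Set
  Realises zero    x E = ⊤
  Realises (suc k) {Q} x E =
    (∀ r → Σ[ e ∈ ⌞ P ⌟ ] (e ∈ E × restrict x r ∼[ k ] restrict w e)) ×
    (∀ e → e ∈ E → Σ[ r ∈ ⌞ Q ⌟ ] (restrict x r ∼[ k ] restrict w e))

  realises? : ∀ k {Q} (x : Mono Q L) E → Dec (Realises k x E)
  realises? zero    x E = yes tt
  realises? (suc k) {Q} x E =
    ∀? (poset Q) (λ r → ∃∈? E (λ e → restrict x r ∼?[ k ] restrict w e)) ×-dec
    ∀∈? E (λ e → ∃? (poset Q) (λ r → restrict x r ∼?[ k ] restrict w e))

  Realises-resp-∼ : ∀ k {Q R} (x : Mono Q L) (y : Mono R L) E → x ∼[ k ] y → Realises k x E → Realises k y E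
  Realises-resp-∼ zero    x y E _ _ = tt
  Realises-resp-∼ (suc k) x y E (forth , back) (cover , hit) =
    (λ r → let p , r₁ = back r ; e , e∈ , r₂ = cover p in e , e∈ , ∼-trans k _ _ _ (∼-sym k _ _ r₁) r₂) ,
    (λ e e∈ → let r , r₁ = hit e e∈ ; q , r₂ = forth r in q , ∼-trans k _ _ _ (∼-sym k _ _ r₂) r₁)

  ∼-of-Realises : ∀ k {Q R} (x : Mono Q L) (y : Mono R L) E →
                  fun x (ρ Q) ≡ fun y (ρ R) → Realises k x E → Realises k y E → x ∼[ k ] y
  ∼-of-Realises zero    x y E xρ≡yρ _ _ = xρ≡yρ
  ∼-of-Realises (suc k) x y E _ (coverₓ , hitₓ) (cover_y , hit_y) =
    (λ r → let e , e∈ , r₁ = coverₓ r ; q , r₂ = hit_y e e∈ in q , ∼-trans k _ _ _ r₁ (∼-sym k _ _ r₂)) ,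
    (λ q → let e , e∈ , r₂ = cover_y q ; r , r₁ = hitₓ e e∈ in r , ∼-trans k _ _ _ r₁ (∼-sym k _ _ r₂))

  ∼-restrict⇔Realises : ∀ k {Q} (x : Mono Q L) e →
                        x ∼[ k ] restrict w e ⇔ (fun x (ρ Q) ≡ fun w e × Realises k x (pointsBelow e))
  ∼-restrict⇔Realises zero    x e = mk⇔ (λ x∼ → x∼ , tt) proj₁
  ∼-restrict⇔Realises (suc k) x e = mk⇔
    (λ x∼@(forth , back) → ∼⇒∼₀ (suc k) x (restrict w e) x∼ ,
      (λ s → let q , r = forth s in
         proj₁ q , ∈-filter⁺ below? (complete (poset P) _) (proj₂ q) ,
         ∼-trans k _ _ _ r (restrict-restrict-≃ w e q k)) ,
      (λ e' e'∈ → let q = e' , proj₂ (∈-filter⁻ below? {xs = enum (poset P)} e'∈) ; s , r = back q in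
         s , ∼-trans k _ _ _ r (restrict-restrict-≃ w e q k)))
    (λ (_ , cover , hit) →
      (λ s → let e' , e'∈ , r = cover s ; q = e' , proj₂ (∈-filter⁻ below? {xs = enum (poset P)} e'∈) in
         q , ∼-trans k _ _ _ r (≃-sym (restrict-restrict-≃ w e q) k)) ,
      (λ q → let s , r = hit (proj₁ q) (∈-filter⁺ below? (complete (poset P) _) (proj₂ q)) in
         s , ∼-trans k _ _ _ r (≃-sym (restrict-restrict-≃ w e q) k)))
    where
      below? : Decidable (λ q → T (le (poset P) q e))
      below? q = T? (le (poset P) q e)

  Unrealised : ℕ → Carrier L → List ⌞ P ⌟ → List ⌞ P ⌟ → Set
  Unrealised k l E' E = ¬ (Σ[ e ∈ ⌞ P ⌟ ] (e ∈ E × fun w e ≡ l × Realises k (restrict w e) E'))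

  unrealised? : ∀ k l E' E → Dec (Unrealised k l E' E)
  unrealised? k l E' E = ¬? (∃∈? E (λ e → _≟_ {L} (fun w e) l ×-dec realises? k (restrict w e) E'))

  Omits            : ℕ → Carrier L → List ⌞ P ⌟ → SubB L
  TypesIn          : ℕ → List ⌞ P ⌟ → SubB L
  OmitsUnrealised  : ℕ → List ⌞ P ⌟ → SubB L

  Omits zero    l E = ι (atMost l) ⇒ₛ ι (below l)
  Omits (suc k) l E =
    (ι (atMost l) ∧ₛ TypesIn k E) ⇒ₛ (ι (below l) ∨ₛ ⋁ₛ E (λ e → Omits k (fun w e) (pointsBelow e)))

  TypesIn zero    E = OmitsUnrealised zero E
  TypesIn (suc k) E = TypesIn k E ∧ₛ OmitsUnrealised (suc k) E

  OmitsUnrealised k E =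
    ⋀ₛ (enum L) λ l → ⋀ₛ (sublists E) λ E' → guardₛ (unrealised? k l E' E) (Omits k l E')

  OmitsSpec : ℕ → Set₁
  OmitsSpec k = ∀ l E {Q} (v : Mono Q L) →
    v ∈ₛ Omits k l E ⇔ (∀ r → ¬ (fun v r ≡ l × Realises k (restrict v r) E))

  TypesInSpec : ℕ → Set₁
  TypesInSpec k = ∀ E {Q} (v : Mono Q L) →
    v ∈ₛ TypesIn k E ⇔ (∀ r → Σ[ e ∈ ⌞ P ⌟ ] (e ∈ E × restrict v r ∼[ k ] restrict w e))

  module _ {k : ℕ} (omits-spec : OmitsSpec k) where

    omits-typeOf : ∀ e {Q} (v : Mono Q L) →
                   v ∈ₛ Omits k (fun w e) (pointsBelow e) ⇔ (∀ r → ¬ (restrict v r ∼[ k ] restrict w e))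
    omits-typeOf e v = mk⇔
      (λ v∈ r vr∼we → to (omits-spec _ _ v) v∈ r (to (∼-restrict⇔Realises k (restrict v r) e) vr∼we))
      (λ H → from (omits-spec _ _ v) λ r vr≃ → H r (from (∼-restrict⇔Realises k (restrict v r) e) vr≃))

    omitsUnrealised-sound : ∀ E {Q} (v : Mono Q L) →
      (∀ r → Σ[ e ∈ ⌞ P ⌟ ] (e ∈ E × restrict v r ∼[ k ] restrict w e)) → v ∈ₛ OmitsUnrealised k E
    omitsUnrealised-sound E v typed =
      from (⋀ₛ-pointwise (enum L) _ v) λ l _ → from (⋀ₛ-pointwise (sublists E) _ v) λ E' _ →
      from (guardₛ-pointwise (unrealised? k l E' E) _ v) λ unrealised →
      from (omits-spec l E' v) λ r (vr≡l , realises) →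
        let e , e∈ , vr∼we = typed r in
        unrealised (e , e∈ , trans (sym (∼⇒∼₀ k _ _ vr∼we)) vr≡l ,
                    Realises-resp-∼ k (restrict v r) (restrict w e) E' vr∼we realises)

    omitsUnrealised-complete : ∀ E {Q} (v : Mono Q L) → v ∈ₛ OmitsUnrealised k E →
      ∀ r E' → E' ∈ sublists E → Realises k (restrict v r) E' →
      Σ[ e ∈ ⌞ P ⌟ ] (e ∈ E × restrict v r ∼[ k ] restrict w e)
    omitsUnrealised-complete E v v∈ r E' E'∈ realises
      with ∃∈? E (λ e → _≟_ {L} (fun w e) (fun v r) ×-dec realises? k (restrict w e) E')
    ... | yes (e , e∈ , we≡vr , realisesₑ) =
          e , e∈ , ∼-of-Realises k (restrict v r) (restrict w e) E' (sym we≡vr) realises realisesₑ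
    ... | no unrealised = ⊥-elim (to (omits-spec (fun v r) E' v) omits r (refl , realises))
      where
        omits : v ∈ₛ Omits k (fun v r) E'
        omits = to (guardₛ-pointwise (unrealised? k (fun v r) E' E) _ v)
                  (to (⋀ₛ-pointwise (sublists E) _ v)
                    (to (⋀ₛ-pointwise (enum L) _ v) v∈ (fun v r) (complete L _)) E' E'∈)
                  unrealised

  omits-zero : OmitsSpec zero
  omits-zero l E v = mk⇔
    (λ v∈ r (vr≡l , _) → proj₂ (to (below-mem {L}) (to pointwise v∈ r (≤-reflexive {L} vr≡l))) vr≡l)
    (λ H → from pointwise λ r vr≤l → from (below-mem {L}) (vr≤l , λ vr≡l → H r (vr≡l , tt)))
    where
      pointwise : v ∈ₛ Omits zero l E ⇔ (∀ r → restrict v r ∈ₛ ι (atMost l) → restrict v r ∈ₛ ι (below l))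
      pointwise = ⇒ₛ-pointwise (ι (atMost l)) (ι (below l)) v

  omits-suc : ∀ k → TypesInSpec k → OmitsSpec k → OmitsSpec (suc k)
  omits-suc k typesIn-spec omits-spec l E {Q} v = mk⇔
    (λ v∈ r (vr≡l , cover , hit) →
      let vr∈ = to (⇒ₛ-pointwise (ι (atMost l) ∧ₛ TypesIn k E) (ι (below l) ∨ₛ ⋁ₛ E _) v) v∈ r
                  (from T-∧ (≤-reflexive {L} vr≡l ,
                             from (typesIn-spec E (restrict v r)) cover))
      in [ (λ vr<l → proj₂ (to (below-mem {L}) vr<l) vr≡l)
         , (λ vr∈⋁ → let e , e∈ , omitsₑ = to (⋁ₛ-pointwise E _ (restrict v r)) vr∈⋁
                         s , r′ = hit e e∈
                     in to (omits-typeOf omits-spec e (restrict v r)) omitsₑ s r′) ]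
         (to T-∨ vr∈))
    (λ H → from (⇒ₛ-pointwise (ι (atMost l) ∧ₛ TypesIn k E) (ι (below l) ∨ₛ ⋁ₛ E _) v) λ r vr∈ →
      let vr≤l , typed = to T-∧ vr∈ in
      from T-∨ (below-or-omits H r vr≤l (to (typesIn-spec E (restrict v r)) typed)))
    where
      below-or-omits : (∀ r → ¬ (fun v r ≡ l × Realises (suc k) (restrict v r) E)) → ∀ r →
        T (le L (fun v r) l) →
        (∀ s → Σ[ e ∈ ⌞ P ⌟ ] (e ∈ E × restrict (restrict v r) s ∼[ k ] restrict w e)) →
        T (dmem (below {L} l) (fun v r)) ⊎ restrict v r ∈ₛ ⋁ₛ E (λ e → Omits k (fun w e) (pointsBelow e))
      below-or-omits H r vr≤l cover = map₂ omits (below⊎≡ {L} vr≤l)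
        where
          omits : fun v r ≡ l → restrict v r ∈ₛ ⋁ₛ E (λ e → Omits k (fun w e) (pointsBelow e))
          omits vr≡l =
            let e , e∈ , unhit = ¬∀∈⇒∃∈¬ E
                  (λ e → ∃? (poset (↓ Q r)) (λ s → restrict (restrict v r) s ∼?[ k ] restrict w e))
                  (λ hit → H r (vr≡l , cover , hit))
            in from (⋁ₛ-pointwise E _ (restrict v r))
                 (e , e∈ , from (omits-typeOf omits-spec e (restrict v r)) (λ s r′ → unhit (s , r′)))

  typesIn-zero : TypesInSpec zero
  typesIn-zero E v = mk⇔
    (λ v∈ r → omitsUnrealised-complete omits-zero E v v∈ r [] ([]∈sublists E) tt)
    (omitsUnrealised-sound omits-zero E v)

  typesIn-suc : ∀ k → TypesInSpec k → OmitsSpec (suc k) → TypesInSpec (suc k)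
  typesIn-suc k typesIn-spec omits-spec E {Q} v = mk⇔
    (λ v∈ r → let typed , omitsU = to T-∧ v∈ in
      omitsUnrealised-complete omits-spec E v omitsU r (filter (hit? r) E) (filter∈sublists (hit? r) E)
        (realises r (to (typesIn-spec E v) typed)))
    (λ typed → from T-∧
      ( from (typesIn-spec E v) (λ r → let e , e∈ , r′ = typed r in e , e∈ , ∼-weaken (n≤1+n k) _ _ r′)
      , omitsUnrealised-sound omits-spec E v typed))
    where
      hit? : ∀ r → Decidable (λ e → Σ[ s ∈ ⌞ ↓ Q r ⌟ ] (restrict (restrict v r) s ∼[ k ] restrict w e))
      hit? r e = ∃? (poset (↓ Q r)) (λ s → restrict (restrict v r) s ∼?[ k ] restrict w e)

      realises : ∀ r → (∀ r → Σ[ e ∈ ⌞ P ⌟ ] (e ∈ E × restrict v r ∼[ k ] restrict w e)) →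
                 Realises (suc k) (restrict v r) (filter (hit? r) E)
      realises r typed =
        (λ s → let e , e∈ , r′ = typed (proj₁ s) ; r″ = ∼-trans k _ _ _ (restrict-restrict-≃ v r s k) r′ in
           e , ∈-filter⁺ (hit? r) e∈ (s , r″) , r″) ,
        (λ e e∈ → proj₂ (∈-filter⁻ (hit? r) {xs = E} e∈))

  specs : ∀ k → OmitsSpec k × TypesInSpec k
  specs zero    = omits-zero , typesIn-zero
  specs (suc k) =
    let omitsₖ , typesInₖ = specs k ; omitsₖ₊₁ = omits-suc k typesInₖ omitsₖ in
    omitsₖ₊₁ , typesIn-suc k typesInₖ omitsₖ₊₁

  omits-spec : ∀ k → OmitsSpec k
  omits-spec k = proj₁ (specs k)

  typesIn-spec : ∀ k → TypesInSpec k
  typesIn-spec k = proj₂ (specs k)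

-- The dual family of a Heyting algebra homomorphism

module Dual {L M : FinPoset} {μ : SubB L → SubB M} (hom : IsHeytingHom μ) where
  open IsHeytingHom hom

  μ-mono : {X Y : SubB L} → (∀ P (u : Mono P L) → u ∈ₛ X → u ∈ₛ Y) →
           {R : Rooted} (x : Mono R M) → x ∈ₛ μ X → x ∈ₛ μ Y
  μ-mono {X} {Y} X⊆Y {R} x x∈ =
    proj₂ (to (μ-meet {X} {X} {Y} (λ P u → mk⇔ (λ u∈ → u∈ , X⊆Y P u u∈) proj₁) R x) x∈)

  μ-⋀ₛ : {A : Set} (as : List A) (X : A → SubB L) {R : Rooted} (x : Mono R M) →
         x ∈ₛ μ (⋀ₛ as X) ⇔ (∀ a → a ∈ as → x ∈ₛ μ (X a))
  μ-⋀ₛ []       X {R} x = mk⇔ (λ _ _ ()) (λ _ → μ-top ⊤ₛ-isTop R x)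
  μ-⋀ₛ (a ∷ as) X {R} x = mk⇔
    (λ x∈ → let y , ys = to (meet R x) x∈ in
      λ { _ (here refl) → y ; b (there b∈) → to (μ-⋀ₛ as X x) ys b b∈ })
    (λ H → from (meet R x) (H a (here refl) , from (μ-⋀ₛ as X x) (λ b b∈ → H b (there b∈))))
    where
      meet : IsMeet (μ (⋀ₛ (a ∷ as) X)) (μ (X a)) (μ (⋀ₛ as X))
      meet = μ-meet (∧ₛ-isMeet (X a) (⋀ₛ as X))

  μ-⋁ₛ : {A : Set} (as : List A) (X : A → SubB L) {R : Rooted} (x : Mono R M) →
         x ∈ₛ μ (⋁ₛ as X) ⇔ (Σ[ a ∈ A ] (a ∈ as × x ∈ₛ μ (X a)))
  μ-⋁ₛ []       X {R} x = mk⇔ (λ x∈ → ⊥-elim (μ-bot ⊥ₛ-isBot R x x∈)) (λ ())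
  μ-⋁ₛ (a ∷ as) X {R} x = mk⇔
    (λ x∈ → [ (λ y → a , here refl , y)
            , (λ ys → let b , b∈ , y = to (μ-⋁ₛ as X x) ys in b , there b∈ , y) ] (to (join R x) x∈))
    (λ { (_ , here refl , y) → from (join R x) (inj₁ y)
       ; (b , there b∈ , y) → from (join R x) (inj₂ (from (μ-⋁ₛ as X x) (b , b∈ , y))) })
    where
      join : IsJoin (μ (⋁ₛ (a ∷ as) X)) (μ (X a)) (μ (⋁ₛ as X))
      join = μ-join (∨ₛ-isJoin (X a) (⋁ₛ as X))

  -- dual x is the least l with x ∈ μ(ι(↓l)).  It exists because x lies in μ of the
  -- meet of all these ι(↓l), and that meet is the join of the ι(↓g) over their
  -- common lower bounds g, so μ puts x into some ι(↓g).
  module _ {R : Rooted} (x : Mono R M) where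
    private
      C? : Decidable (λ l → x ∈ₛ μ (ι (atMost l)))
      C? l = T? _

      Cs : List (Carrier L)
      Cs = filter C? (enum L)

      lowerBound? : Decidable (λ y → ∀ l → l ∈ Cs → T (le L y l))
      lowerBound? y = ∀∈? Cs (λ l → T? (le L y l))

      ⋀≈⋁ : ⋀ₛ Cs (λ l → ι (atMost l)) ≈ₛ ⋁-atMost lowerBound?
      ⋀≈⋁ = ≈ₛ-⋁-atMost {L} lowerBound? (λ y≤z z≤ l l∈ → le-trans L y≤z (z≤ l l∈))
              (⋀ₛ Cs (λ l → ι (atMost l))) (λ P u → ⋀ₛ-pointwise Cs _ u)

      least : Σ[ g ∈ Carrier L ] (g ∈ filter lowerBound? (enum L) × x ∈ₛ μ (ι (atMost g)))
      least = to (μ-⋁ₛ (filter lowerBound? (enum L)) _ x) (to (μ-cong ⋀≈⋁ R x)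
                (from (μ-⋀ₛ Cs _ x) (λ l l∈ → proj₂ (∈-filter⁻ C? {xs = enum L} l∈))))

    dual : Carrier L
    dual = proj₁ least

    dual-atMost : x ∈ₛ μ (ι (atMost dual))
    dual-atMost = proj₂ (proj₂ least)

    dual-least : (l : Carrier L) → x ∈ₛ μ (ι (atMost l)) → T (le L dual l)
    dual-least l x∈ =
      proj₂ (∈-filter⁻ lowerBound? {xs = enum L} (proj₁ (proj₂ least))) l (∈-filter⁺ C? (complete L l) x∈)

    dual-spec : (d : Downset L) → T (dmem d dual) ⇔ x ∈ₛ μ (ι d)
    dual-spec d = mk⇔
      (λ dual∈d → μ-mono (λ P u uρ≤dual → dclosed d uρ≤dual dual∈d) x dual-atMost)
      (λ x∈ → let l , l∈ , x∈↓l = to (μ-⋁ₛ (filter d? (enum L)) _ x) (to (μ-cong d≈⋁ R x) x∈) in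
         dclosed d (dual-least l x∈↓l) (proj₂ (∈-filter⁻ d? {xs = enum L} l∈)))
      where
        d? : Decidable (λ y → T (dmem d y))
        d? y = T? (dmem d y)
        d≈⋁ : ι d ≈ₛ ⋁-atMost d?
        d≈⋁ = ≈ₛ-⋁-atMost {L} d? (dclosed d) (ι d) (λ P u → mk⇔ (λ u∈ → u∈) (λ u∈ → u∈))

  dual-cong : {R S : Rooted} (x : Mono R M) (y : Mono S M) →
              (∀ l → x ∈ₛ μ (ι (atMost l)) → y ∈ₛ μ (ι (atMost l))) →
              (∀ l → y ∈ₛ μ (ι (atMost l)) → x ∈ₛ μ (ι (atMost l))) → dual x ≡ dual y
  dual-cong x y x⇒y y⇒x = le-antisym L
    (dual-least x (dual y) (y⇒x _ (dual-atMost y)))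
    (dual-least y (dual x) (x⇒y _ (dual-atMost x)))

  μ* : Family M L
  μ* P u = record
    { fun  = λ p → dual (restrict u p)
    ; mono = λ {p} {p'} p≤p' → dual-least (restrict u p) _
        (∈ₛ-resp-≃ (μ (ι (atMost _))) (restrict-restrict-≃ u p' (p , p≤p'))
          (∈ₛ-restrict (μ (ι (atMost _))) (restrict u p') (p , p≤p') (dual-atMost (restrict u p'))))
    }

  μ*-isStar : IsStar (λ X P u → u ∈ₛ μ X) μ*
  μ*-isStar P u p = dual-spec (restrict u p)

  μ*-natural : IsNatural μ*
  μ*-natural h u q = dual-cong _ _
    (λ l → ∈ₛ-resp-≃ (μ (ι (atMost l))) (restrict-∘ᵒ-≃ h u q))
    (λ l → ∈ₛ-resp-≃ (μ (ι (atMost l))) (≃-sym (restrict-∘ᵒ-≃ h u q)))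

  μ*-bindex : ℕ
  μ*-bindex = max 0 (map (λ l → bindex (μ (ι (atMost l)))) (enum L))

  bindex≤μ*-bindex : ∀ l → bindex (μ (ι (atMost l))) ≤ μ*-bindex
  bindex≤μ*-bindex l =
    All-lookup (xs≤max 0 (map (λ l → bindex (μ (ι (atMost l)))) (enum L))) (∈-map⁺ _ (complete L l))

  μ*-hasBIndex : HasBIndex μ* μ*-bindex
  μ*-hasBIndex u v u∼v = dual-cong _ _ (λ l → transport l u∼v) (λ l → transport l (∼-sym _ u v u∼v))
    where
      transport : ∀ l {P Q} {u : Mono P M} {v : Mono Q M} → u ∼[ μ*-bindex ] v →
                  restrict u (ρ P) ∈ₛ μ (ι (atMost l)) → restrict v (ρ Q) ∈ₛ μ (ι (atMost l))
      transport l {u = u} {v} u∼v uρ∈ =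
        ∈ₛ-resp-≃ X (≃-sym (restrict-ρ-≃ v))
          (∈ₛ-resp-∼ X (bindex≤μ*-bindex l) u∼v (∈ₛ-resp-≃ X (restrict-ρ-≃ u) uρ∈))
        where
          X : SubB M
          X = μ (ι (atMost l))

  μ*-∘ᵒ-≃ : {P Q : Rooted} (h : Open Q P) (u : Mono P M) → μ* Q (u ∘ᵒ h) ≃ (μ* P u ∘ᵒ h)
  μ*-∘ᵒ-≃ h u = ≃-pointwise _ _ (μ*-natural h u)

  Compatible : SubB L → Set₁
  Compatible X = ∀ P (u : Mono P M) → μ* P u ∈ₛ X ⇔ u ∈ₛ μ X

  compatible-ι : (d : Downset L) → Compatible (ι d)
  compatible-ι d P u = mk⇔
    (λ u*∈ → ∈ₛ-resp-≃ (μ (ι d)) (restrict-ρ-≃ u) (to (dual-spec (restrict u (ρ P)) d) u*∈))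
    (λ u∈ → from (dual-spec (restrict u (ρ P)) d) (∈ₛ-resp-≃ (μ (ι d)) (≃-sym (restrict-ρ-≃ u)) u∈))

  compatible-⊤ₛ : Compatible ⊤ₛ
  compatible-⊤ₛ P u = mk⇔ (λ _ → μ-top ⊤ₛ-isTop P u) (λ _ → tt)

  compatible-⊥ₛ : Compatible ⊥ₛ
  compatible-⊥ₛ P u = mk⇔ (λ ()) (λ u∈ → ⊥-elim (μ-bot ⊥ₛ-isBot P u u∈))

  compatible-∧ₛ : (X Y : SubB L) → Compatible X → Compatible Y → Compatible (X ∧ₛ Y)
  compatible-∧ₛ X Y compatibleX compatibleY P u =
    ⇔-trans T-∧ (⇔-trans (compatibleX P u ×-⇔ compatibleY P u) (⇔-sym (μ-meet (∧ₛ-isMeet X Y) P u)))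

  compatible-∨ₛ : (X Y : SubB L) → Compatible X → Compatible Y → Compatible (X ∨ₛ Y)
  compatible-∨ₛ X Y compatibleX compatibleY P u =
    ⇔-trans T-∨ (⇔-trans (compatibleX P u ⊎-⇔ compatibleY P u) (⇔-sym (μ-join (∨ₛ-isJoin X Y) P u)))

  compatible-⇒ₛ : (X Y : SubB L) → Compatible X → Compatible Y → Compatible (X ⇒ₛ Y)
  compatible-⇒ₛ X Y compatibleX compatibleY P u = mk⇔
    (λ u*∈ → from (μ-imp (⇒ₛ-isImp X Y) P u) λ Q h uh∈X →
      let e = μ*-∘ᵒ-≃ h u in
      to (compatibleY Q (u ∘ᵒ h)) (∈ₛ-resp-≃ Y (≃-sym e)
        (to (⇒ₛ-isImp X Y P (μ* P u)) u*∈ Q h (∈ₛ-resp-≃ X e (from (compatibleX Q (u ∘ᵒ h)) uh∈X)))))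
    (λ u∈ → from (⇒ₛ-isImp X Y P (μ* P u)) λ Q h u*h∈X →
      let e = μ*-∘ᵒ-≃ h u in
      ∈ₛ-resp-≃ Y e (from (compatibleY Q (u ∘ᵒ h))
        (to (μ-imp (⇒ₛ-isImp X Y) P u) u∈ Q h (to (compatibleX Q (u ∘ᵒ h)) (∈ₛ-resp-≃ X (≃-sym e) u*h∈X)))))

  compatible-⋀ₛ : {A : Set} (as : List A) (X : A → SubB L) →
                  (∀ a → Compatible (X a)) → Compatible (⋀ₛ as X)
  compatible-⋀ₛ []       X compatible = compatible-⊤ₛ
  compatible-⋀ₛ (a ∷ as) X compatible =
    compatible-∧ₛ (X a) (⋀ₛ as X) (compatible a) (compatible-⋀ₛ as X compatible)

  compatible-⋁ₛ : {A : Set} (as : List A) (X : A → SubB L) →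
                  (∀ a → Compatible (X a)) → Compatible (⋁ₛ as X)
  compatible-⋁ₛ []       X compatible = compatible-⊥ₛ
  compatible-⋁ₛ (a ∷ as) X compatible =
    compatible-∨ₛ (X a) (⋁ₛ as X) (compatible a) (compatible-⋁ₛ as X compatible)

  compatible-guardₛ : {B : Set} (B? : Dec B) (X : SubB L) → Compatible X → Compatible (guardₛ B? X)
  compatible-guardₛ (yes _) X compatible = compatible
  compatible-guardₛ (no _)  X compatible = compatible-⊤ₛ

  module _ {P : Rooted} (w : Mono P L) where
    open Types w

    compatible-Omits           : ∀ k l E → Compatible (Omits k l E)
    compatible-TypesIn         : ∀ k E → Compatible (TypesIn k E)
    compatible-OmitsUnrealised : ∀ k E → Compatible (OmitsUnrealised k E)

    compatible-Omits zero    l E = compatible-⇒ₛ _ _ (compatible-ι (atMost l)) (compatible-ι (below l))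
    compatible-Omits (suc k) l E =
      compatible-⇒ₛ _ _ (compatible-∧ₛ _ _ (compatible-ι (atMost l)) (compatible-TypesIn k E))
        (compatible-∨ₛ _ _ (compatible-ι (below l))
          (compatible-⋁ₛ E _ (λ e → compatible-Omits k (fun w e) (pointsBelow e))))

    compatible-TypesIn zero    E = compatible-OmitsUnrealised zero E
    compatible-TypesIn (suc k) E =
      compatible-∧ₛ _ _ (compatible-TypesIn k E) (compatible-OmitsUnrealised (suc k) E)

    compatible-OmitsUnrealised k E =
      compatible-⋀ₛ (enum L) _ λ l → compatible-⋀ₛ (sublists E) _ λ E' →
      compatible-guardₛ (unrealised? k l E' E) _ (compatible-Omits k l E')

  μ*-∈ₛ : ∀ (X : SubB L) P (u : Mono P M) → μ* P u ∈ₛ X ⇔ u ∈ₛ μ X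
  μ*-∈ₛ X P u = mk⇔ w∈X⇒u∈μX u∈μX⇒w∈X
    where
      w : Mono P L
      w = μ* P u
      n : ℕ
      n = bindex X
      open Types w

      w∈X⇒u∈μX : w ∈ₛ X → u ∈ₛ μ X
      w∈X⇒u∈μX w∈X = μ-mono typesIn⊆X u (to (compatible-TypesIn w n (enum (poset P)) P u) w∈typesIn)
        where
          w∈typesIn : w ∈ₛ TypesIn n (enum (poset P))
          w∈typesIn = from (typesIn-spec n _ w) λ r → r , complete (poset P) r , ≃-refl (restrict w r) n
          typesIn⊆X : ∀ Q (v : Mono Q L) → v ∈ₛ TypesIn n (enum (poset P)) → v ∈ₛ X
          typesIn⊆X Q v v∈ = let e , _ , vρ∼we = to (typesIn-spec n _ v) v∈ (ρ Q) in
            ∈ₛ-resp-≃ X (restrict-ρ-≃ v)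
              (bclosed X (restrict w e) _ (∈ₛ-restrict X w e w∈X) (∼-sym n _ _ vρ∼we))

      u∈μX⇒w∈X : u ∈ₛ μ X → w ∈ₛ X
      u∈μX⇒w∈X u∈μX = decidable-stable (T? (mem X P w)) λ w∉X →
        let X⊆omits : ∀ Q (v : Mono Q L) → v ∈ₛ X → v ∈ₛ Omits n (fun w (ρ P)) (pointsBelow (ρ P))
            X⊆omits Q v v∈X = from (omits-typeOf (omits-spec n) (ρ P) v) λ r vr∼wρ →
              w∉X (∈ₛ-resp-≃ X (restrict-ρ-≃ w)
                (bclosed X (restrict v r) _ (∈ₛ-restrict X v r v∈X) vr∼wρ))
            w∈omits = from (compatible-Omits w n _ _ P u) (μ-mono X⊆omits u u∈μX)
        in to (omits-typeOf (omits-spec n) (ρ P) w) w∈omits (ρ P) (≃-refl _ n)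

preimage-star : {L M : FinPoset} (f : Family M L) → IsNatural f → IsStar (preimage f) f
preimage-star f natural P u p d =
  mk⇔ (subst (λ x → T (dmem d x)) fp≡) (subst (λ x → T (dmem d x)) (sym fp≡))
  where
    fp≡ : fun (f P u) p ≡ fun (f (↓ P p) (restrict u p)) (ρ (↓ P p))
    fp≡ = sym (natural (inclₒ P p) u (ρ (↓ P p)))

mainTheorem11 : (L M : FinPoset) →
    ((μ : SubB L → SubB M) → IsHeytingHom μ →
      Σ[ μ* ∈ Family M L ]
        ( IsStar (λ X P u → u ∈ₛ μ X) μ*
        × (∀ (X : SubB L) (P : Rooted) (u : Mono P M) → (μ* P u ∈ₛ X) ⇔ (u ∈ₛ μ X))
        × (IsNatural μ* × Σ[ n ∈ ℕ ] HasBIndex μ* n)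
        × (∀ (X : SubB L) (P : Rooted) (u : Mono P M) → (u ∈ₛ μ X) ⇔ preimage μ* X P u)))
    × ((f : Family M L) → IsNatural f → (n : ℕ) → HasBIndex f n → IsStar (preimage f) f)
mainTheorem11 L M =
  (λ μ hom → let open Dual hom in
    μ* , μ*-isStar , μ*-∈ₛ , (μ*-natural , μ*-bindex , μ*-hasBIndex) ,
    (λ X P u → ⇔-sym (μ*-∈ₛ X P u))) ,
  (λ f natural _ _ → preimage-star f natural)
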